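{- Let $n\ge1$ and $m\ge 2n-2$ be integers, and consider the table with $m$ rows and $n$ columns. Then (i) $\sum_{i=0}^{n-1}\mathcal{D}(i,1)\mathcal{D}(n-i,1)=3^{n-1}$; (ii) $\sum_{i=1}^{n-1}\mathcal{D}(i,1)\mathcal{D}(n-i,1)=\sum_{i=0}^{n-2}3^{n-i-2}\mathcal{M}_i$; (iii) $\mathcal{I}_m(n)=(3m-2n+2)3^{n-2}+2\sum_{k=0}^{n-3}(n-k-2)3^{n-k-3}\mathcal{M}_k$.
   Context: $\mathcal{I}_m(n)$ is the number of sequences $(r_1,\dots,r_n)$ with $r_i\in\{1,\dots,m\}$, $|r_{i+1}-r_i|\le1$ (lattice paths with steps $(1,0),(1,1),(1,-1)$ from the first to the last column of the $m$-row, $n$-column table, staying inside). For $s\ge1$, $\mathcal{D}(s,t)$ is the number of sequences $(r_1,\dots,r_s)$ with values in $\{1,\dots,m\}$, $|r_{i+1}-r_i|\le1$ and $r_s=t$ (paths from any cell of the first column to the cell in column $s$, row $t$); by convention $\mathcal{D}(0,1)=1$. $\mathcal{M}_k$ is the $k$-th Motzkin number (lattice paths from $(0,0)$ to $(k,0)$ with steps $(1,1),(1,-1),(1,0)$ never going below the $x$-axis; $\mathcal{M}_0=1$). Empty sums are $0$. -}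

module Defs where

open import Data.Nat using (ℕ; zero; suc; _+_; _*_; _∸_; _≤ᵇ_; _≡ᵇ_; ∣_-_∣)
open import Data.Bool using (Bool; true; false; _∧_; if_then_else_)
open import Data.List using (List; []; _∷_; map; concatMap; filterᵇ; length; upTo)
open import Data.Nat.ListAction using (sum)

seqs : ℕ → ℕ → List (List ℕ)
seqs m zero    = [] ∷ []
seqs m (suc s) = concatMap (λ r → map (r ∷_) (seqs m s)) (map suc (upTo m))

adjOK : List ℕ → Bool
adjOK []             = true
adjOK (x ∷ [])       = true
adjOK (x ∷ y ∷ rest) = (∣ x - y ∣ ≤ᵇ 1) ∧ adjOK (y ∷ rest)

lastIs : ℕ → List ℕ → Bool
lastIs t []             = false
lastIs t (x ∷ [])       = x ≡ᵇ t
lastIs t (x ∷ y ∷ rest) = lastIs t (y ∷ rest)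

I : ℕ → ℕ → ℕ
I m n = length (filterᵇ adjOK (seqs m n))

-- 𝓓(s,t) for the table with m rows; convention 𝓓(0,1) = 1 (and 𝓓(0,t) = 0 otherwise, never used)
D : ℕ → ℕ → ℕ → ℕ
D m zero    t = if t ≡ᵇ 1 then 1 else 0
D m (suc s) t = length (filterᵇ (λ l → adjOK l ∧ lastIs t l) (seqs m (suc s)))

data Step : Set where
  U Dn F : Step

steps : ℕ → List (List Step)
steps zero    = [] ∷ []
steps (suc k) = concatMap (λ st → map (st ∷_) (steps k)) (U ∷ Dn ∷ F ∷ [])

motzOK : ℕ → List Step → Bool
motzOK h       []        = h ≡ᵇ 0
motzOK h       (U ∷ s)   = motzOK (suc h) s
motzOK zero    (Dn ∷ s)  = false
motzOK (suc h) (Dn ∷ s)  = motzOK h s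
motzOK h       (F ∷ s)   = motzOK h s

Motzkin : ℕ → ℕ
Motzkin k = length (filterᵇ (motzOK 0) (steps k))

-- Σ_{i=a}^{b-1} f i  (half-open range a ≤ i < b; empty if b ≤ a)
Σ[_,_⟩ : ℕ → ℕ → (ℕ → ℕ) → ℕ
Σ[ a , b ⟩ f = sum (map (λ i → f (a + i)) (upTo (b ∸ a)))

-- Walks in the table are counted by iterating the adjacency operator of its rows. A walk of fewer than
-- m steps can feel at most one wall, so the walks of s steps ending (by symmetry of adjacency, also
-- starting) at row 1 or row m are counted by the number T(s) of Motzkin prefixes of length s, and
-- 𝓓(s+1,1) = T(s). Extending prefixes step by step gives T(s+1) = 3T(s) − M_s, and splitting a prefix
-- at its last visit to height 0 gives T(s+1) = M_{s+1} + Σ_b M_b T(s−b). Together they yield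
-- 3^s = T(s) + Σ_{b<s} M_b 3^(s−1−b) and Σ_i T(i) T(j−i) = Σ_b M_b 3^(j−b), i.e. (i) and (ii).
-- For (iii), applying the adjacency operator to all rows counts every walk three times except for the
-- missing neighbours at the two walls, so 𝓘_m(s+2) = 3 𝓘_m(s+1) − 2 T(s), which solves to the closed form.

module Submission where

open import Defs
open import Data.Bool using (Bool; true; false; _∧_; if_then_else_; T)
open import Data.Bool.Properties using (∧-assoc; ∧-identityʳ)
open import Data.Empty using (⊥-elim)
open import Data.List using (List; []; _∷_; _++_; map; concatMap; filterᵇ; length; upTo; applyUpTo)
open import Data.List.Properties using (map-∘)
open import Data.Nat
open import Data.Nat.ListAction using (sum)
open import Data.Nat.Properties
open import Data.Nat.Tactic.RingSolver using (solve-∀)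
open import Data.Product using (_×_; _,_)
open import Data.Sum using (inj₁; inj₂)
open import Relation.Binary.PropositionalEquality
open import Relation.Nullary using (yes; no)
open ≡-Reasoning

∑< : ℕ → (ℕ → ℕ) → ℕ
∑< zero    f = 0
∑< (suc n) f = f 0 + ∑< n (λ i → f (suc i))

syntax ∑< n (λ i → e) = ∑[ i < n ] e

+-*-zeroʳ : ∀ a b → a + b * 0 ≡ a
+-*-zeroʳ a b = trans (cong (a +_) (*-zeroʳ b)) (+-identityʳ a)

∑-cong : ∀ n {f g : ℕ → ℕ} → (∀ i → i < n → f i ≡ g i) → ∑< n f ≡ ∑< n g
∑-cong zero    f≡g = refl
∑-cong (suc n) f≡g = cong₂ _+_ (f≡g 0 z<s) (∑-cong n (λ i i<n → f≡g (suc i) (s<s i<n)))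

∑-zero : ∀ n → ∑[ i < n ] 0 ≡ 0
∑-zero zero    = refl
∑-zero (suc n) = ∑-zero n

∑-one : ∀ n → ∑[ i < n ] 1 ≡ n
∑-one zero    = refl
∑-one (suc n) = cong suc (∑-one n)

∑-snoc : ∀ n f → ∑< (suc n) f ≡ ∑< n f + f n
∑-snoc zero    f = +-comm (f 0) 0
∑-snoc (suc n) f = trans (cong (f 0 +_) (∑-snoc n (λ i → f (suc i)))) (sym (+-assoc (f 0) _ _))

∑-+ : ∀ n f g → ∑[ i < n ] (f i + g i) ≡ ∑< n f + ∑< n g
∑-+ zero    f g = refl
∑-+ (suc n) f g rewrite ∑-+ n (λ i → f (suc i)) (λ i → g (suc i)) = interchange (f 0) (g 0) _ _
  where interchange : ∀ a b c d → a + b + (c + d) ≡ a + c + (b + d)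
        interchange = solve-∀

∑-reverse : ∀ n f → ∑[ i < n ] f (n ∸ suc i) ≡ ∑< n f
∑-reverse zero    f = refl
∑-reverse (suc n) f = begin
  f n + ∑[ i < n ] f (n ∸ suc i)  ≡⟨ cong (f n +_) (∑-reverse n f) ⟩
  f n + ∑< n f                    ≡⟨ +-comm (f n) _ ⟩
  ∑< n f + f n                    ≡⟨ ∑-snoc n f ⟨
  ∑< (suc n) f                    ∎

Σ[⟩-as-∑ : ∀ a b f → Σ[ a , b ⟩ f ≡ ∑[ i < b ∸ a ] f (a + i)
Σ[⟩-as-∑ a b f = sum-applyUpTo (b ∸ a) (λ i → i)
  where
  sum-applyUpTo : ∀ n (g : ℕ → ℕ) → sum (map (λ i → f (a + i)) (applyUpTo g n)) ≡ ∑[ i < n ] f (a + g i)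
  sum-applyUpTo zero    g = refl
  sum-applyUpTo (suc n) g = cong (f (a + g 0) +_) (sum-applyUpTo n (λ i → g (suc i)))

𝟙 : Bool → ℕ
𝟙 true  = 1
𝟙 false = 0

count : {A : Set} → (A → Bool) → List A → ℕ
count p xs = length (filterᵇ p xs)

count-∷ : {A : Set} (p : A → Bool) (x : A) (xs : List A) → count p (x ∷ xs) ≡ 𝟙 (p x) + count p xs
count-∷ p x xs with p x
... | true  = refl
... | false = refl

count-++ : {A : Set} (p : A → Bool) (xs ys : List A) → count p (xs ++ ys) ≡ count p xs + count p ys
count-++ p []       ys = refl
count-++ p (x ∷ xs) ys rewrite count-∷ p x (xs ++ ys) | count-∷ p x xs | count-++ p xs ys =
  sym (+-assoc (𝟙 (p x)) _ _)

count-map : {A B : Set} (p : B → Bool) (f : A → B) (xs : List A) → count p (map f xs) ≡ count (λ a → p (f a)) xs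
count-map p f []       = refl
count-map p f (x ∷ xs) rewrite count-∷ p (f x) (map f xs) | count-∷ (λ a → p (f a)) x xs | count-map p f xs = refl

count-concatMap : {A B : Set} (p : B → Bool) (g : A → List B) (xs : List A) →
                  count p (concatMap g xs) ≡ sum (map (λ a → count p (g a)) xs)
count-concatMap p g []       = refl
count-concatMap p g (x ∷ xs) rewrite count-++ p (g x) (concatMap g xs) | count-concatMap p g xs = refl

count-cong : {A : Set} {p q : A → Bool} (xs : List A) → (∀ a → p a ≡ q a) → count p xs ≡ count q xs
count-cong {p = p} {q} []       p≡q = refl
count-cong {p = p} {q} (x ∷ xs) p≡q
  rewrite count-∷ p x xs | count-∷ q x xs | p≡q x | count-cong xs p≡q = refl

count-false : {A : Set} (xs : List A) → count (λ _ → false) xs ≡ 0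
count-false []       = refl
count-false (x ∷ xs) = count-false xs

count-guard : {A : Set} (b : Bool) (q : A → Bool) (xs : List A) →
              count (λ a → b ∧ q a) xs ≡ (if b then count q xs else 0)
count-guard true  q xs = refl
count-guard false q xs = count-false xs

count-seqs : ∀ m s (p : List ℕ → Bool) → count p (seqs m (suc s)) ≡ ∑[ i < m ] count (λ l → p (suc i ∷ l)) (seqs m s)
count-seqs m s p = begin
  count p (seqs m (suc s))
    ≡⟨ count-concatMap p (λ r → map (r ∷_) (seqs m s)) (map suc (upTo m)) ⟩
  sum (map (λ r → count p (map (r ∷_) (seqs m s))) (map suc (upTo m)))
    ≡⟨ cong sum (map-∘ (upTo m)) ⟨
  sum (map (λ i → count p (map (suc i ∷_) (seqs m s))) (upTo m))
    ≡⟨ Σ[⟩-as-∑ 0 m (λ i → count p (map (suc i ∷_) (seqs m s))) ⟩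
  ∑[ i < m ] count p (map (suc i ∷_) (seqs m s))
    ≡⟨ ∑-cong m (λ i _ → count-map p (suc i ∷_) (seqs m s)) ⟩
  ∑[ i < m ] count (λ l → p (suc i ∷ l)) (seqs m s) ∎

infixl 7 _⋆_

_⋆_ : (ℕ → ℕ) → (ℕ → ℕ) → ℕ → ℕ
(f ⋆ g) zero    = f 0 * g 0
(f ⋆ g) (suc j) = f 0 * g (suc j) + ((λ a → f (suc a)) ⋆ g) j

⋆-as-∑ : ∀ f g j → (f ⋆ g) j ≡ ∑[ a < suc j ] (f a * g (j ∸ a))
⋆-as-∑ f g zero    = sym (+-identityʳ _)
⋆-as-∑ f g (suc j) = cong (f 0 * g (suc j) +_) (⋆-as-∑ (λ a → f (suc a)) g j)

⋆-snoc : ∀ f g j → (f ⋆ g) (suc j) ≡ (f ⋆ (λ b → g (suc b))) j + f (suc j) * g 0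
⋆-snoc f g zero    = refl
⋆-snoc f g (suc j) rewrite ⋆-snoc (λ a → f (suc a)) g j = sym (+-assoc (f 0 * g (suc (suc j))) _ _)

⋆-congˡ : ∀ {f f′} g j → (∀ a → a ≤ j → f a ≡ f′ a) → (f ⋆ g) j ≡ (f′ ⋆ g) j
⋆-congˡ g zero    f≡f′ = cong (_* g 0) (f≡f′ 0 z≤n)
⋆-congˡ g (suc j) f≡f′ =
  cong₂ _+_ (cong (_* g (suc j)) (f≡f′ 0 z≤n)) (⋆-congˡ g j (λ a a≤j → f≡f′ (suc a) (s≤s a≤j)))

⋆-congʳ : ∀ f {g g′} j → (∀ b → b ≤ j → g b ≡ g′ b) → (f ⋆ g) j ≡ (f ⋆ g′) j
⋆-congʳ f zero    g≡g′ = cong (f 0 *_) (g≡g′ 0 z≤n)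
⋆-congʳ f (suc j) g≡g′ =
  cong₂ _+_ (cong (f 0 *_) (g≡g′ (suc j) ≤-refl)) (⋆-congʳ (λ a → f (suc a)) j (λ b b≤j → g≡g′ b (m≤n⇒m≤1+n b≤j)))

⋆-distribˡ-+ : ∀ f g h j → (f ⋆ (λ b → g b + h b)) j ≡ (f ⋆ g) j + (f ⋆ h) j
⋆-distribˡ-+ f g h zero    = *-distribˡ-+ (f 0) (g 0) (h 0)
⋆-distribˡ-+ f g h (suc j) rewrite ⋆-distribˡ-+ (λ a → f (suc a)) g h j = lemma (f 0) (g (suc j)) (h (suc j)) _ _
  where lemma : ∀ a x y u v → a * (x + y) + (u + v) ≡ a * x + u + (a * y + v)
        lemma = solve-∀

⋆-distribʳ-+ : ∀ f f′ g j → ((λ a → f a + f′ a) ⋆ g) j ≡ (f ⋆ g) j + (f′ ⋆ g) j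
⋆-distribʳ-+ f f′ g zero    = *-distribʳ-+ (g 0) (f 0) (f′ 0)
⋆-distribʳ-+ f f′ g (suc j) rewrite ⋆-distribʳ-+ (λ a → f (suc a)) (λ a → f′ (suc a)) g j =
  lemma (f 0) (f′ 0) (g (suc j)) _ _
  where lemma : ∀ a b x u v → (a + b) * x + (u + v) ≡ a * x + u + (b * x + v)
        lemma = solve-∀

⋆-scaleˡ : ∀ c f g j → ((λ a → c * f a) ⋆ g) j ≡ c * (f ⋆ g) j
⋆-scaleˡ c f g zero    = *-assoc c (f 0) (g 0)
⋆-scaleˡ c f g (suc j) rewrite ⋆-scaleˡ c (λ a → f (suc a)) g j = lemma (f 0) c (g (suc j)) _
  where lemma : ∀ a c x u → c * a * x + c * u ≡ c * (a * x + u)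
        lemma = solve-∀

⋆-scaleʳ : ∀ c f g j → (f ⋆ (λ b → c * g b)) j ≡ c * (f ⋆ g) j
⋆-scaleʳ c f g zero    = lemma (f 0) c (g 0)
  where lemma : ∀ a c x → a * (c * x) ≡ c * (a * x)
        lemma = solve-∀
⋆-scaleʳ c f g (suc j) rewrite ⋆-scaleʳ c (λ a → f (suc a)) g j = lemma (f 0) c (g (suc j)) _
  where lemma : ∀ a c x u → a * (c * x) + c * u ≡ c * (a * x + u)
        lemma = solve-∀

⋆-zeroʳ : ∀ f j → (f ⋆ (λ _ → 0)) j ≡ 0
⋆-zeroʳ f zero    = *-zeroʳ (f 0)
⋆-zeroʳ f (suc j) rewrite ⋆-zeroʳ (λ a → f (suc a)) j | *-zeroʳ (f 0) = refl

∑-⋆ : ∀ K f (g : ℕ → ℕ → ℕ) j → ∑[ h < K ] (f ⋆ g h) j ≡ (f ⋆ (λ b → ∑[ h < K ] g h b)) j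
∑-⋆ zero    f g j = sym (⋆-zeroʳ f j)
∑-⋆ (suc K) f g j rewrite ∑-⋆ K f (λ h → g (suc h)) j = sym (⋆-distribˡ-+ f (g 0) (λ b → ∑[ h < K ] g (suc h) b) j)

-- Motzkin triangle: paths of s Motzkin steps from height 0 to height h that never go below 0
prefixes : ℕ → ℕ → ℕ
prefixes zero    zero    = 1
prefixes zero    (suc h) = 0
prefixes (suc s) zero    = prefixes s 0 + prefixes s 1
prefixes (suc s) (suc h) = prefixes s h + prefixes s (suc h) + prefixes s (suc (suc h))

prefixes-vanish : ∀ s h → s < h → prefixes s h ≡ 0
prefixes-vanish zero    (suc h) _         = refl
prefixes-vanish (suc s) (suc h) (s<s s<h)
  rewrite prefixes-vanish s h s<h
        | prefixes-vanish s (suc h) (m<n⇒m<1+n s<h)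
        | prefixes-vanish s (suc (suc h)) (m<n⇒m<1+n (m<n⇒m<1+n s<h)) = refl

motzkin : ℕ → ℕ
motzkin k = prefixes k 0

count-motzOK : ∀ k h → count (motzOK h) (steps k) ≡ prefixes k h
count-motzOK zero    zero    = refl
count-motzOK zero    (suc h) = refl
count-motzOK (suc k) h = begin
  count (motzOK h) (steps (suc k))
    ≡⟨ count-concatMap (motzOK h) (λ st → map (st ∷_) (steps k)) (U ∷ Dn ∷ F ∷ []) ⟩
  count (motzOK h) (map (U ∷_) (steps k)) + (count (motzOK h) (map (Dn ∷_) (steps k))
    + (count (motzOK h) (map (F ∷_) (steps k)) + 0))
    ≡⟨ cong₂ _+_ (count-map (motzOK h) (U ∷_) (steps k))
                 (cong₂ _+_ (count-map (motzOK h) (Dn ∷_) (steps k))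
                            (cong (_+ 0) (count-map (motzOK h) (F ∷_) (steps k)))) ⟩
  count (motzOK (suc h)) (steps k) + (count (λ l → motzOK h (Dn ∷ l)) (steps k) + (count (motzOK h) (steps k) + 0))
    ≡⟨ cong₂ (λ a b → a + (count (λ l → motzOK h (Dn ∷ l)) (steps k) + (b + 0)))
             (count-motzOK k (suc h)) (count-motzOK k h) ⟩
  prefixes k (suc h) + (count (λ l → motzOK h (Dn ∷ l)) (steps k) + (prefixes k h + 0))
    ≡⟨ by-last-step h ⟩
  prefixes (suc k) h ∎
  where
  by-last-step : ∀ h → prefixes k (suc h) + (count (λ l → motzOK h (Dn ∷ l)) (steps k) + (prefixes k h + 0))
                       ≡ prefixes (suc k) h
  by-last-step zero rewrite count-false (steps k) = lemma (prefixes k 1) (prefixes k 0)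
    where lemma : ∀ a b → a + (0 + (b + 0)) ≡ b + a
          lemma = solve-∀
  by-last-step (suc h) rewrite count-motzOK k h = lemma (prefixes k (suc (suc h))) (prefixes k h) (prefixes k (suc h))
    where lemma : ∀ a b c → a + (b + (c + 0)) ≡ b + c + a
          lemma = solve-∀

Motzkin≡motzkin : ∀ k → Motzkin k ≡ motzkin k
Motzkin≡motzkin k = count-motzOK k 0

prefixes-last-return : ∀ j h → prefixes (suc j) (suc h) ≡ (motzkin ⋆ (λ b → prefixes b h)) j
prefixes-last-return zero    zero    = refl
prefixes-last-return zero    (suc h) = refl
prefixes-last-return (suc j) zero    = begin
  prefixes (suc j) 0 + prefixes (suc j) 1 + prefixes (suc j) 2
    ≡⟨ cong₂ (λ a b → prefixes (suc j) 0 + a + b) (prefixes-last-return j 0) (prefixes-last-return j 1) ⟩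
  motzkin (suc j) + (motzkin ⋆ (λ b → prefixes b 0)) j + (motzkin ⋆ (λ b → prefixes b 1)) j
    ≡⟨ lemma (motzkin (suc j)) _ _ ⟩
  (motzkin ⋆ (λ b → prefixes b 0)) j + (motzkin ⋆ (λ b → prefixes b 1)) j + motzkin (suc j) * 1
    ≡⟨ cong (_+ motzkin (suc j) * 1) (⋆-distribˡ-+ motzkin (λ b → prefixes b 0) (λ b → prefixes b 1) j) ⟨
  (motzkin ⋆ (λ b → prefixes (suc b) 0)) j + motzkin (suc j) * 1
    ≡⟨ ⋆-snoc motzkin (λ b → prefixes b 0) j ⟨
  (motzkin ⋆ (λ b → prefixes b 0)) (suc j) ∎
  where lemma : ∀ a x y → a + x + y ≡ x + y + a * 1
        lemma = solve-∀
prefixes-last-return (suc j) (suc h) = begin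
  prefixes (suc j) (suc h) + prefixes (suc j) (suc (suc h)) + prefixes (suc j) (suc (suc (suc h)))
    ≡⟨ cong₂ _+_ (cong₂ _+_ (prefixes-last-return j h) (prefixes-last-return j (suc h)))
                 (prefixes-last-return j (suc (suc h))) ⟩
  (motzkin ⋆ (λ b → prefixes b h)) j + (motzkin ⋆ (λ b → prefixes b (suc h))) j
    + (motzkin ⋆ (λ b → prefixes b (suc (suc h)))) j
    ≡⟨ cong (_+ (motzkin ⋆ (λ b → prefixes b (suc (suc h)))) j)
            (⋆-distribˡ-+ motzkin (λ b → prefixes b h) (λ b → prefixes b (suc h)) j) ⟨
  (motzkin ⋆ (λ b → prefixes b h + prefixes b (suc h))) j + (motzkin ⋆ (λ b → prefixes b (suc (suc h)))) j
    ≡⟨ ⋆-distribˡ-+ motzkin (λ b → prefixes b h + prefixes b (suc h)) (λ b → prefixes b (suc (suc h))) j ⟨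
  (motzkin ⋆ (λ b → prefixes (suc b) (suc h))) j
    ≡⟨ +-*-zeroʳ ((motzkin ⋆ (λ b → prefixes (suc b) (suc h))) j) (motzkin (suc j)) ⟨
  (motzkin ⋆ (λ b → prefixes (suc b) (suc h))) j + motzkin (suc j) * 0
    ≡⟨ ⋆-snoc motzkin (λ b → prefixes b (suc h)) j ⟨
  (motzkin ⋆ (λ b → prefixes b (suc h))) (suc j) ∎

prefixTotal : ℕ → ℕ
prefixTotal s = ∑< (suc s) (prefixes s)

∑-prefixes : ∀ s K → s < K → ∑< K (prefixes s) ≡ prefixTotal s
∑-prefixes s (suc K) s<1+K with m<1+n⇒m<n∨m≡n s<1+K
... | inj₂ refl = refl
... | inj₁ s<K  = begin
  ∑< (suc K) (prefixes s)           ≡⟨ ∑-snoc K (prefixes s) ⟩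
  ∑< K (prefixes s) + prefixes s K  ≡⟨ cong₂ _+_ (∑-prefixes s K s<K) (prefixes-vanish s K s<K) ⟩
  prefixTotal s + 0                 ≡⟨ +-identityʳ _ ⟩
  prefixTotal s                     ∎

∑-prefixes-suc : ∀ K s → ∑< (suc K) (prefixes (suc s)) + prefixes s 0
                       ≡ ∑< K (prefixes s) + ∑< (suc K) (prefixes s) + ∑< (suc (suc K)) (prefixes s)
∑-prefixes-suc zero    s = lemma (prefixes s 0) (prefixes s 1)
  where lemma : ∀ a b → a + b + 0 + a ≡ 0 + (a + 0) + (a + (b + 0))
        lemma = solve-∀
∑-prefixes-suc (suc K) s = begin
  ∑< (suc (suc K)) (prefixes (suc s)) + prefixes s 0
    ≡⟨ cong (_+ prefixes s 0) (∑-snoc (suc K) (prefixes (suc s))) ⟩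
  ∑< (suc K) (prefixes (suc s)) + prefixes (suc s) (suc K) + prefixes s 0
    ≡⟨ swap (∑< (suc K) (prefixes (suc s))) (prefixes (suc s) (suc K)) (prefixes s 0) ⟩
  ∑< (suc K) (prefixes (suc s)) + prefixes s 0 + prefixes (suc s) (suc K)
    ≡⟨ cong (_+ prefixes (suc s) (suc K)) (∑-prefixes-suc K s) ⟩
  S₀ + S₁ + S₂ + (prefixes s K + prefixes s (suc K) + prefixes s (suc (suc K)))
    ≡⟨ lemma S₀ S₁ S₂ (prefixes s K) (prefixes s (suc K)) (prefixes s (suc (suc K))) ⟩
  (S₀ + prefixes s K) + (S₁ + prefixes s (suc K)) + (S₂ + prefixes s (suc (suc K)))
    ≡⟨ cong₂ _+_ (cong₂ _+_ (∑-snoc K (prefixes s)) (∑-snoc (suc K) (prefixes s))) (∑-snoc (suc (suc K)) (prefixes s)) ⟨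
  ∑< (suc K) (prefixes s) + ∑< (suc (suc K)) (prefixes s) + ∑< (suc (suc (suc K))) (prefixes s) ∎
  where
  S₀ = ∑< K (prefixes s)
  S₁ = ∑< (suc K) (prefixes s)
  S₂ = ∑< (suc (suc K)) (prefixes s)
  swap : ∀ a b c → a + b + c ≡ a + c + b
  swap = solve-∀
  lemma : ∀ a b c x y z → a + b + c + (x + y + z) ≡ (a + x) + (b + y) + (c + z)
  lemma = solve-∀

-- Each prefix extends by three steps, except that one ending at height 0 cannot step down.
prefixTotal-step : ∀ s → prefixTotal (suc s) + motzkin s ≡ 3 * prefixTotal s
prefixTotal-step s = begin
  prefixTotal (suc s) + motzkin s
    ≡⟨ ∑-prefixes-suc (suc s) s ⟩
  prefixTotal s + ∑< (suc (suc s)) (prefixes s) + ∑< (suc (suc (suc s))) (prefixes s)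
    ≡⟨ cong₂ (λ a b → prefixTotal s + a + b) (∑-prefixes s _ (m<n⇒m<1+n (n<1+n s)))
                                              (∑-prefixes s _ (m<n⇒m<1+n (m<n⇒m<1+n (n<1+n s)))) ⟩
  prefixTotal s + prefixTotal s + prefixTotal s
    ≡⟨ lemma (prefixTotal s) ⟩
  3 * prefixTotal s ∎
  where lemma : ∀ a → a + a + a ≡ 3 * a
        lemma = solve-∀

prefixTotal-last-return : ∀ j → prefixTotal (suc j) ≡ motzkin (suc j) + (motzkin ⋆ prefixTotal) j
prefixTotal-last-return j = cong (motzkin (suc j) +_) (begin
  ∑[ h < suc j ] prefixes (suc j) (suc h)
    ≡⟨ ∑-cong (suc j) (λ h _ → prefixes-last-return j h) ⟩
  ∑[ h < suc j ] (motzkin ⋆ (λ b → prefixes b h)) j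
    ≡⟨ ∑-⋆ (suc j) motzkin (λ h b → prefixes b h) j ⟩
  (motzkin ⋆ (λ b → ∑< (suc j) (prefixes b))) j
    ≡⟨ ⋆-congʳ motzkin j (λ b b≤j → ∑-prefixes b (suc j) (s≤s b≤j)) ⟩
  (motzkin ⋆ prefixTotal) j ∎)

shiftedMotzkin : ℕ → ℕ
shiftedMotzkin zero    = 0
shiftedMotzkin (suc k) = motzkin k

shiftedMotzkin⋆pow3-suc : ∀ s → (shiftedMotzkin ⋆ (3 ^_)) (suc s) ≡ 3 * (shiftedMotzkin ⋆ (3 ^_)) s + motzkin s
shiftedMotzkin⋆pow3-suc s = trans (⋆-snoc shiftedMotzkin (3 ^_) s)
                                  (cong₂ _+_ (⋆-scaleʳ 3 shiftedMotzkin (3 ^_) s) (*-identityʳ (motzkin s)))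

pow3-split : ∀ s → 3 ^ s ≡ prefixTotal s + (shiftedMotzkin ⋆ (3 ^_)) s
pow3-split zero    = refl
pow3-split (suc s) = begin
  3 * 3 ^ s                                 ≡⟨ cong (3 *_) (pow3-split s) ⟩
  3 * (prefixTotal s + C s)                 ≡⟨ *-distribˡ-+ 3 (prefixTotal s) (C s) ⟩
  3 * prefixTotal s + 3 * C s               ≡⟨ cong (_+ 3 * C s) (prefixTotal-step s) ⟨
  prefixTotal (suc s) + motzkin s + 3 * C s ≡⟨ lemma (prefixTotal (suc s)) (motzkin s) (3 * C s) ⟩
  prefixTotal (suc s) + (3 * C s + motzkin s) ≡⟨ cong (prefixTotal (suc s) +_) (shiftedMotzkin⋆pow3-suc s) ⟨
  prefixTotal (suc s) + C (suc s)           ∎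
  where
  C = shiftedMotzkin ⋆ (3 ^_)
  lemma : ∀ a b c → a + b + c ≡ a + (c + b)
  lemma = solve-∀

prefixTotal⋆prefixTotal : ∀ j → (prefixTotal ⋆ prefixTotal) j ≡ (shiftedMotzkin ⋆ (3 ^_)) (suc j)
prefixTotal⋆prefixTotal zero    = refl
prefixTotal⋆prefixTotal (suc j) = begin
  A (suc j)                      ≡⟨ +-cancelʳ-≡ ((motzkin ⋆ t) j) _ _ with-last-returns ⟩
  motzkin (suc j) + 3 * A j      ≡⟨ cong (λ x → motzkin (suc j) + 3 * x) (prefixTotal⋆prefixTotal j) ⟩
  motzkin (suc j) + 3 * C (suc j) ≡⟨ +-comm (motzkin (suc j)) _ ⟩
  3 * C (suc j) + motzkin (suc j) ≡⟨ shiftedMotzkin⋆pow3-suc (suc j) ⟨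
  C (suc (suc j))                ∎
  where
  t = prefixTotal
  A = t ⋆ t
  C = shiftedMotzkin ⋆ (3 ^_)
  shifted : ((λ a → t (suc a)) ⋆ t) j + (motzkin ⋆ t) j ≡ 3 * A j
  shifted = begin
    ((λ a → t (suc a)) ⋆ t) j + (motzkin ⋆ t) j  ≡⟨ ⋆-distribʳ-+ (λ a → t (suc a)) motzkin t j ⟨
    ((λ a → t (suc a) + motzkin a) ⋆ t) j        ≡⟨ ⋆-congˡ t j (λ a _ → prefixTotal-step a) ⟩
    ((λ a → 3 * t a) ⋆ t) j                      ≡⟨ ⋆-scaleˡ 3 t t j ⟩
    3 * A j                                      ∎
  with-last-returns : A (suc j) + (motzkin ⋆ t) j ≡ motzkin (suc j) + 3 * A j + (motzkin ⋆ t) j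
  with-last-returns = begin
    t 0 * t (suc j) + ((λ a → t (suc a)) ⋆ t) j + (motzkin ⋆ t) j
      ≡⟨ +-assoc (t 0 * t (suc j)) _ _ ⟩
    t 0 * t (suc j) + (((λ a → t (suc a)) ⋆ t) j + (motzkin ⋆ t) j)
      ≡⟨ cong₂ _+_ (*-identityˡ (t (suc j))) shifted ⟩
    t (suc j) + 3 * A j
      ≡⟨ cong (_+ 3 * A j) (prefixTotal-last-return j) ⟩
    motzkin (suc j) + (motzkin ⋆ t) j + 3 * A j
      ≡⟨ lemma (motzkin (suc j)) ((motzkin ⋆ t) j) (3 * A j) ⟩
    motzkin (suc j) + 3 * A j + (motzkin ⋆ t) j ∎
    where lemma : ∀ a b c → a + b + c ≡ a + c + b
          lemma = solve-∀

-- The rows of the table are 1, …, m and rowInd m is their indicator function.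
rowInd : ℕ → ℕ → ℕ
rowInd zero    x             = 0
rowInd (suc m) zero          = 0
rowInd (suc m) (suc zero)    = 1
rowInd (suc m) (suc (suc x)) = rowInd m (suc x)

IsRow : ℕ → ℕ → Set
IsRow m x = rowInd m x ≡ 1

rowInd-zero : ∀ m → rowInd m 0 ≡ 0
rowInd-zero zero    = refl
rowInd-zero (suc m) = refl

rowInd-in : ∀ m x → suc x ≤ m → IsRow m (suc x)
rowInd-in (suc m) zero    _         = refl
rowInd-in (suc m) (suc x) (s≤s x<m) = rowInd-in m x x<m

rowInd-out : ∀ m x → m ≤ x → rowInd m (suc x) ≡ 0
rowInd-out zero    x       _         = refl
rowInd-out (suc m) (suc x) (s≤s m≤x) = rowInd-out m x m≤x

IsRow⇒< : ∀ m x → IsRow m (suc x) → x < m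
IsRow⇒< m x row with x <? m
... | yes x<m = x<m
... | no  x≮m with () ← trans (sym (rowInd-out m x (≮⇒≥ x≮m))) row

rowInd-guard : ∀ m x a b → (IsRow m x → a ≡ b) → rowInd m x * a ≡ rowInd m x * b
rowInd-guard m zero    a b a≡b rewrite rowInd-zero m = refl
rowInd-guard m (suc x) a b a≡b with x <? m
... | yes x<m = cong (rowInd m (suc x) *_) (a≡b (rowInd-in m x x<m))
... | no  x≮m rewrite rowInd-out m x (≮⇒≥ x≮m) = refl

rowInd-edge : ∀ m x a b → (suc x ≤ m → a ≡ b) → (m ≤ x → b ≡ 0) → rowInd m (suc x) * a ≡ b
rowInd-edge m x a b inside outside with x <? m
... | yes x<m rewrite rowInd-in m x x<m = trans (+-identityʳ a) (inside x<m)
... | no  x≮m rewrite rowInd-out m x (≮⇒≥ x≮m) = sym (outside (≮⇒≥ x≮m))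

-- The clause for 0, which is not a row, is chosen so that adjacentSum≡neighbourSum holds for every r.
neighbourSum : ℕ → (ℕ → ℕ) → ℕ → ℕ
neighbourSum m v zero    = rowInd m 1 * v 1
neighbourSum m v (suc r) = rowInd m r * v r + rowInd m (suc r) * v (suc r) + rowInd m (suc (suc r)) * v (suc (suc r))

adjacentSum≡neighbourSum : ∀ m v r → ∑[ i < m ] (if ∣ r - suc i ∣ ≤ᵇ 1 then v (suc i) else 0) ≡ neighbourSum m v r
adjacentSum≡neighbourSum zero    v zero    = refl
adjacentSum≡neighbourSum zero    v (suc r) = refl
adjacentSum≡neighbourSum (suc m) v zero    =
  trans (cong (v 1 +_) (∑-zero m)) (trans (+-identityʳ (v 1)) (sym (+-identityʳ (v 1))))
adjacentSum≡neighbourSum (suc m) v (suc zero) = begin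
  v 1 + A                             ≡⟨ cong (v 1 +_) (adjacentSum≡neighbourSum m (λ x → v (suc x)) 0) ⟩
  v 1 + rowInd m 1 * v 2              ≡⟨ cong (_+ rowInd m 1 * v 2) (+-identityʳ (v 1)) ⟨
  0 + (v 1 + 0) + rowInd m 1 * v 2    ∎
  where A = ∑[ i < m ] (if ∣ 0 - suc i ∣ ≤ᵇ 1 then v (suc (suc i)) else 0)
adjacentSum≡neighbourSum (suc m) v (suc (suc zero)) = begin
  v 1 + A
    ≡⟨ cong (v 1 +_) (adjacentSum≡neighbourSum m (λ x → v (suc x)) 1) ⟩
  v 1 + (rowInd m 0 * v 1 + rowInd m 1 * v 2 + rowInd m 2 * v 3)
    ≡⟨ cong (λ z → v 1 + (z * v 1 + rowInd m 1 * v 2 + rowInd m 2 * v 3)) (rowInd-zero m) ⟩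
  v 1 + (rowInd m 1 * v 2 + rowInd m 2 * v 3)
    ≡⟨ lemma (v 1) _ _ ⟩
  (v 1 + 0) + rowInd m 1 * v 2 + rowInd m 2 * v 3 ∎
  where A = ∑[ i < m ] (if ∣ 1 - suc i ∣ ≤ᵇ 1 then v (suc (suc i)) else 0)
        lemma : ∀ a b c → a + (b + c) ≡ (a + 0) + b + c
        lemma = solve-∀
adjacentSum≡neighbourSum (suc m) v (suc (suc (suc r))) = adjacentSum≡neighbourSum m (λ x → v (suc x)) (suc (suc r))

-- walks m w s r: walks of s steps from row r, each weighted by w at its final row
walks : ℕ → (ℕ → ℕ) → ℕ → ℕ → ℕ
walks m w zero    r = w r
walks m w (suc s) r = neighbourSum m (walks m w s) r

count-walks : ∀ m (p : List ℕ → Bool) (w : ℕ → ℕ) →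
              (∀ x → 𝟙 (p (x ∷ [])) ≡ w x) → (∀ x y l → p (x ∷ y ∷ l) ≡ p (y ∷ l)) →
              ∀ s r → count (λ l → adjOK (r ∷ l) ∧ p (r ∷ l)) (seqs m s) ≡ walks m w s r
count-walks m p w single tail zero    r =
  trans (count-∷ (λ l → adjOK (r ∷ l) ∧ p (r ∷ l)) [] []) (trans (+-identityʳ (𝟙 (p (r ∷ [])))) (single r))
count-walks m p w single tail (suc s) r = begin
  count (λ l → adjOK (r ∷ l) ∧ p (r ∷ l)) (seqs m (suc s))
    ≡⟨ count-seqs m s _ ⟩
  ∑[ i < m ] count (λ l → ((∣ r - suc i ∣ ≤ᵇ 1) ∧ adjOK (suc i ∷ l)) ∧ p (r ∷ suc i ∷ l)) (seqs m s)
    ≡⟨ ∑-cong m (λ i _ → count-cong (seqs m s) (λ l →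
         trans (cong (((∣ r - suc i ∣ ≤ᵇ 1) ∧ adjOK (suc i ∷ l)) ∧_) (tail r (suc i) l))
               (∧-assoc (∣ r - suc i ∣ ≤ᵇ 1) _ _))) ⟩
  ∑[ i < m ] count (λ l → (∣ r - suc i ∣ ≤ᵇ 1) ∧ (adjOK (suc i ∷ l) ∧ p (suc i ∷ l))) (seqs m s)
    ≡⟨ ∑-cong m (λ i _ → count-guard (∣ r - suc i ∣ ≤ᵇ 1) _ (seqs m s)) ⟩
  ∑[ i < m ] (if ∣ r - suc i ∣ ≤ᵇ 1 then count (λ l → adjOK (suc i ∷ l) ∧ p (suc i ∷ l)) (seqs m s) else 0)
    ≡⟨ ∑-cong m (λ i _ → cong (λ c → if ∣ r - suc i ∣ ≤ᵇ 1 then c else 0) (count-walks m p w single tail s (suc i))) ⟩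
  ∑[ i < m ] (if ∣ r - suc i ∣ ≤ᵇ 1 then walks m w s (suc i) else 0)
    ≡⟨ adjacentSum≡neighbourSum m (walks m w s) r ⟩
  walks m w (suc s) r ∎

δ : ℕ → ℕ → ℕ
δ a b = 𝟙 (a ≡ᵇ b)

walksBetween : ℕ → ℕ → ℕ → ℕ → ℕ
walksBetween m s r t = walks m (λ x → δ x t) s r

walksFrom : ℕ → ℕ → ℕ → ℕ
walksFrom m = walks m (λ _ → 1)

D-as-walks : ∀ m s t → D m (suc s) t ≡ ∑[ i < m ] walksBetween m s (suc i) t
D-as-walks m s t = trans (count-seqs m s _)
  (∑-cong m (λ i _ → count-walks m (lastIs t) (λ x → δ x t) (λ _ → refl) (λ _ _ _ → refl) s (suc i)))

I-as-walks : ∀ m s → I m (suc s) ≡ ∑[ i < m ] walksFrom m s (suc i)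
I-as-walks m s = trans (count-seqs m s _) (∑-cong m (λ i _ →
  trans (count-cong (seqs m s) (λ l → sym (∧-identityʳ (adjOK (suc i ∷ l)))))
        (count-walks m (λ _ → true) (λ _ → 1) (λ _ → refl) (λ _ _ _ → refl) s (suc i))))

neighbourSum-cong : ∀ m {v w} → (∀ x → IsRow m x → v x ≡ w x) → ∀ r → neighbourSum m v r ≡ neighbourSum m w r
neighbourSum-cong m v≡w zero    = rowInd-guard m 1 _ _ (v≡w 1)
neighbourSum-cong m v≡w (suc r) =
  cong₂ _+_ (cong₂ _+_ (rowInd-guard m r _ _ (v≡w r)) (rowInd-guard m (suc r) _ _ (v≡w (suc r))))
            (rowInd-guard m (suc (suc r)) _ _ (v≡w (suc (suc r))))

neighbourSum-zero : ∀ m r → neighbourSum m (λ _ → 0) r ≡ 0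
neighbourSum-zero m zero    = *-zeroʳ (rowInd m 1)
neighbourSum-zero m (suc r)
  rewrite *-zeroʳ (rowInd m r) | *-zeroʳ (rowInd m (suc r)) | *-zeroʳ (rowInd m (suc (suc r))) = refl

neighbourSum-+ : ∀ m v w r → neighbourSum m (λ x → v x + w x) r ≡ neighbourSum m v r + neighbourSum m w r
neighbourSum-+ m v w zero    = *-distribˡ-+ (rowInd m 1) (v 1) (w 1)
neighbourSum-+ m v w (suc r) =
  lemma (rowInd m r) (rowInd m (suc r)) (rowInd m (suc (suc r)))
        (v r) (v (suc r)) (v (suc (suc r))) (w r) (w (suc r)) (w (suc (suc r)))
  where lemma : ∀ a b c x y z x′ y′ z′ →
                a * (x + x′) + b * (y + y′) + c * (z + z′) ≡ a * x + b * y + c * z + (a * x′ + b * y′ + c * z′)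
        lemma = solve-∀

neighbourSum-∑ : ∀ m K (v : ℕ → ℕ → ℕ) r → neighbourSum m (λ x → ∑[ i < K ] v i x) r ≡ ∑[ i < K ] neighbourSum m (v i) r
neighbourSum-∑ m zero    v r = neighbourSum-zero m r
neighbourSum-∑ m (suc K) v r =
  trans (neighbourSum-+ m (v 0) (λ x → ∑[ i < K ] v (suc i) x) r)
        (cong (neighbourSum m (v 0) r +_) (neighbourSum-∑ m K (λ i → v (suc i)) r))

neighbourSum-comm : ∀ m (X : ℕ → ℕ → ℕ) ρ τ →
                    neighbourSum m (λ x → neighbourSum m (X x) τ) ρ ≡ neighbourSum m (λ y → neighbourSum m (λ x → X x y) ρ) τ
neighbourSum-comm m X zero    zero    = refl
neighbourSum-comm m X zero    (suc t) =
  one-three (rowInd m 1) (rowInd m t) (rowInd m (suc t)) (rowInd m (suc (suc t))) (X 1 t) (X 1 (suc t)) (X 1 (suc (suc t)))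
  where one-three : ∀ a b c d e f g → a * (b * e + c * f + d * g) ≡ b * (a * e) + c * (a * f) + d * (a * g)
        one-three = solve-∀
neighbourSum-comm m X (suc r) zero    =
  sym (one-three (rowInd m 1) (rowInd m r) (rowInd m (suc r)) (rowInd m (suc (suc r)))
                 (X r 1) (X (suc r) 1) (X (suc (suc r)) 1))
  where one-three : ∀ a b c d e f g → a * (b * e + c * f + d * g) ≡ b * (a * e) + c * (a * f) + d * (a * g)
        one-three = solve-∀
neighbourSum-comm m X (suc r) (suc t) =
  three-three (rowInd m r) (rowInd m (suc r)) (rowInd m (suc (suc r))) (rowInd m t) (rowInd m (suc t)) (rowInd m (suc (suc t)))
              (X r t) (X r (suc t)) (X r (suc (suc t))) (X (suc r) t) (X (suc r) (suc t)) (X (suc r) (suc (suc t)))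
              (X (suc (suc r)) t) (X (suc (suc r)) (suc t)) (X (suc (suc r)) (suc (suc t)))
  where three-three : ∀ a₁ a₂ a₃ b₁ b₂ b₃ x₁₁ x₁₂ x₁₃ x₂₁ x₂₂ x₂₃ x₃₁ x₃₂ x₃₃ →
          a₁ * (b₁ * x₁₁ + b₂ * x₁₂ + b₃ * x₁₃) + a₂ * (b₁ * x₂₁ + b₂ * x₂₂ + b₃ * x₂₃) + a₃ * (b₁ * x₃₁ + b₂ * x₃₂ + b₃ * x₃₃)
          ≡ b₁ * (a₁ * x₁₁ + a₂ * x₂₁ + a₃ * x₃₁) + b₂ * (a₁ * x₁₂ + a₂ * x₂₂ + a₃ * x₃₂) + b₃ * (a₁ * x₁₃ + a₂ * x₂₃ + a₃ * x₃₃)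
        three-three = solve-∀

walks-cong : ∀ m {v w} → (∀ x → IsRow m x → v x ≡ w x) → ∀ s r → IsRow m r → walks m v s r ≡ walks m w s r
walks-cong m v≡w zero    r row = v≡w r row
walks-cong m v≡w (suc s) r row = neighbourSum-cong m (λ x row′ → walks-cong m v≡w s x row′) r

∑-walks : ∀ m K (w : ℕ → ℕ → ℕ) s r → ∑[ i < K ] walks m (w i) s r ≡ walks m (λ x → ∑[ i < K ] w i x) s r
∑-walks m K w zero    r = refl
∑-walks m K w (suc s) r =
  trans (sym (neighbourSum-∑ m K (λ i → walks m (w i) s) r)) (neighbourSum-cong m (λ x _ → ∑-walks m K w s x) r)

δ-sym : ∀ a b → δ a b ≡ δ b a
δ-sym zero    zero    = refl
δ-sym zero    (suc b) = refl
δ-sym (suc a) zero    = refl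
δ-sym (suc a) (suc b) = δ-sym a b

δ-guard : ∀ a b x y → (a ≡ b → x ≡ y) → x * δ a b ≡ y * δ a b
δ-guard a b x y x≡y with a ≡ᵇ b in eq
... | true  = cong (_* 1) (x≡y (≡ᵇ⇒≡ a b (subst T (sym eq) _)))
... | false = trans (*-zeroʳ x) (sym (*-zeroʳ y))

∑-δ : ∀ m r → r < m → ∑[ i < m ] δ r i ≡ 1
∑-δ (suc m) zero    _         = cong suc (∑-zero m)
∑-δ (suc m) (suc r) (s≤s r<m) = ∑-δ m r r<m

adjacent-sym : ∀ m ρ τ → IsRow m ρ → IsRow m τ → neighbourSum m (λ x → δ x τ) ρ ≡ neighbourSum m (δ ρ) τ
adjacent-sym m zero    τ       row _ with () ← trans (sym (rowInd-zero m)) row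
adjacent-sym m (suc ρ) zero    _ row with () ← trans (sym (rowInd-zero m)) row
adjacent-sym m (suc r) (suc t) ρ-row τ-row = begin
  rowInd m r * δ r (suc t) + rowInd m (suc r) * δ r t + rowInd m (suc (suc r)) * δ (suc r) t
    ≡⟨ cong₂ _+_ (cong₂ _+_ below (cong (_* δ r t) (trans ρ-row (sym τ-row)))) above ⟩
  rowInd m (suc (suc t)) * δ r (suc t) + rowInd m (suc t) * δ r t + rowInd m t * δ (suc r) t
    ≡⟨ lemma (rowInd m (suc (suc t)) * δ r (suc t)) (rowInd m (suc t) * δ r t) (rowInd m t * δ (suc r) t) ⟩
  rowInd m t * δ (suc r) t + rowInd m (suc t) * δ r t + rowInd m (suc (suc t)) * δ r (suc t) ∎
  where
  below : rowInd m r * δ r (suc t) ≡ rowInd m (suc (suc t)) * δ r (suc t)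
  below = δ-guard r (suc t) (rowInd m r) (rowInd m (suc (suc t))) (λ { refl → trans τ-row (sym ρ-row) })
  above : rowInd m (suc (suc r)) * δ (suc r) t ≡ rowInd m t * δ (suc r) t
  above = δ-guard (suc r) t (rowInd m (suc (suc r))) (rowInd m t) (λ { refl → trans τ-row (sym ρ-row) })
  lemma : ∀ a b c → a + b + c ≡ c + b + a
  lemma = solve-∀

neighbourSum-walksBetween : ∀ m s ρ τ → IsRow m ρ → IsRow m τ →
                            neighbourSum m (λ x → walksBetween m s x τ) ρ ≡ neighbourSum m (walksBetween m s ρ) τ
neighbourSum-walksBetween m zero    ρ τ ρ-row τ-row = adjacent-sym m ρ τ ρ-row τ-row
neighbourSum-walksBetween m (suc s) ρ τ ρ-row τ-row = begin
  neighbourSum m (λ x → neighbourSum m (λ y → walksBetween m s y τ) x) ρ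
    ≡⟨ neighbourSum-cong m (λ x x-row → neighbourSum-walksBetween m s x τ x-row τ-row) ρ ⟩
  neighbourSum m (λ x → neighbourSum m (walksBetween m s x) τ) ρ
    ≡⟨ neighbourSum-comm m (walksBetween m s) ρ τ ⟩
  neighbourSum m (λ y → neighbourSum m (λ x → walksBetween m s x y) ρ) τ ∎

walksBetween-sym : ∀ m s ρ τ → IsRow m ρ → IsRow m τ → walksBetween m s ρ τ ≡ walksBetween m s τ ρ
walksBetween-sym m zero    ρ τ _     _     = δ-sym ρ τ
walksBetween-sym m (suc s) ρ τ ρ-row τ-row = begin
  neighbourSum m (λ x → walksBetween m s x τ) ρ
    ≡⟨ neighbourSum-cong m (λ x x-row → walksBetween-sym m s x τ x-row τ-row) ρ ⟩
  neighbourSum m (walksBetween m s τ) ρ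
    ≡⟨ neighbourSum-walksBetween m s τ ρ τ-row ρ-row ⟨
  neighbourSum m (λ x → walksBetween m s x ρ) τ ∎

walksFrom-as-∑ : ∀ m s r → IsRow m r → walksFrom m s r ≡ ∑[ t < m ] walksBetween m s r (suc t)
walksFrom-as-∑ m s r row = trans (walks-cong m one s r row) (sym (∑-walks m m (λ t x → δ x (suc t)) s r))
  where
  one : ∀ x → IsRow m x → 1 ≡ ∑[ t < m ] δ x (suc t)
  one zero    row′ with () ← trans (sym (rowInd-zero m)) row′
  one (suc x) row′ = sym (∑-δ m x (IsRow⇒< m x row′))

-- Within s < m steps a walk ending at row 1 cannot feel the top wall, so the table looks like a half-line.
walksBetween-to-bottom : ∀ m s → s < m → ∀ r → suc r ≤ m → walksBetween m s (suc r) 1 ≡ prefixes s r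
walksBetween-to-bottom m zero    s<m zero    _ = refl
walksBetween-to-bottom m zero    s<m (suc r) _ = refl
walksBetween-to-bottom m (suc s) s<m zero    _ rewrite rowInd-zero m =
  cong₂ _+_ (rowInd-edge m 0 _ _ (IH 0) (λ m≤0 → ⊥-elim (<⇒≱ (≤-trans z<s s<m) m≤0)))
            (rowInd-edge m 1 _ _ (IH 1) (λ m≤1 → ⊥-elim (<⇒≱ (≤-trans (s≤s z<s) s<m) m≤1)))
  where IH = walksBetween-to-bottom m s (<⇒≤ s<m)
walksBetween-to-bottom m (suc s) s<m (suc r) r<m =
  cong₂ _+_ (cong₂ _+_ (rowInd-edge m r _ _ (IH r) (λ m≤r → ⊥-elim (<⇒≱ (≤-trans (n≤1+n (suc r)) r<m) m≤r)))
                       (rowInd-edge m (suc r) _ _ (IH (suc r)) (λ m≤1+r → ⊥-elim (<⇒≱ r<m m≤1+r))))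
            (rowInd-edge m (suc (suc r)) _ _ (IH (suc (suc r)))
              (λ m≤2+r → prefixes-vanish s (suc (suc r)) (≤-trans (≤-trans (n≤1+n (suc s)) s<m) m≤2+r)))
  where IH = walksBetween-to-bottom m s (<⇒≤ s<m)

walksBetween-to-top : ∀ m s → s < m → ∀ r k → suc r + k ≡ m → walksBetween m s (suc r) m ≡ prefixes s k
walksBetween-to-top m zero    s<m r k refl = δ-shift (suc r) k
  where
  δ-shift : ∀ a k → δ a (a + k) ≡ prefixes 0 k
  δ-shift zero    zero    = refl
  δ-shift zero    (suc k) = refl
  δ-shift (suc a) k       = δ-shift a k
walksBetween-to-top m (suc s) s<m r zero    1+r+0≡m = begin
  rowInd m r * W r + rowInd m (suc r) * W (suc r) + rowInd m (suc (suc r)) * W (suc (suc r))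
    ≡⟨ cong₂ _+_ (cong₂ _+_ (below r 1+r≡m)
                            (rowInd-edge m r _ _ (λ _ → IH r 0 1+r+0≡m) (λ m≤r → ⊥-elim (<⇒≱ 1+r≤m m≤r))))
                 (cong (_* W (suc (suc r))) (rowInd-out m (suc r) (≤-reflexive (sym 1+r≡m)))) ⟩
  prefixes s 1 + prefixes s 0 + 0
    ≡⟨ lemma (prefixes s 1) (prefixes s 0) ⟩
  prefixes s 0 + prefixes s 1 ∎
  where
  W = λ x → walksBetween m s x m
  IH = walksBetween-to-top m s (<⇒≤ s<m)
  1+r≡m : suc r ≡ m
  1+r≡m = trans (sym (+-identityʳ (suc r))) 1+r+0≡m
  1+r≤m : suc r ≤ m
  1+r≤m = ≤-reflexive 1+r≡m
  below : ∀ x → suc x ≡ m → rowInd m x * W x ≡ prefixes s 1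
  below zero    1≡m = ⊥-elim (<⇒≱ s<m (≤-trans (≤-reflexive (sym 1≡m)) (s≤s z≤n)))
  below (suc x) 2+x≡m = rowInd-edge m x _ _ (λ _ → IH x 1 (trans (+-comm (suc x) 1) 2+x≡m))
                          (λ m≤x → ⊥-elim (<⇒≱ (≤-trans (n≤1+n (suc x)) (≤-reflexive 2+x≡m)) m≤x))
  lemma : ∀ a b → a + b + 0 ≡ b + a
  lemma = solve-∀
walksBetween-to-top m (suc s) s<m r (suc k) 1+r+1+k≡m = begin
  rowInd m r * W r + rowInd m (suc r) * W (suc r) + rowInd m (suc (suc r)) * W (suc (suc r))
    ≡⟨ cong₂ _+_ (cong₂ _+_ (below r 1+r+1+k≡m)
                            (rowInd-edge m r _ _ (λ _ → IH r (suc k) 1+r+1+k≡m) (λ m≤r → ⊥-elim (<⇒≱ 1+r≤m m≤r))))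
                 (rowInd-edge m (suc r) _ _ (λ _ → IH (suc r) k (trans (sym (+-suc (suc r) k)) 1+r+1+k≡m))
                                            (λ m≤1+r → ⊥-elim (<⇒≱ 2+r≤m m≤1+r))) ⟩
  prefixes s (suc (suc k)) + prefixes s (suc k) + prefixes s k
    ≡⟨ lemma (prefixes s (suc (suc k))) (prefixes s (suc k)) (prefixes s k) ⟩
  prefixes s k + prefixes s (suc k) + prefixes s (suc (suc k)) ∎
  where
  W = λ x → walksBetween m s x m
  IH = walksBetween-to-top m s (<⇒≤ s<m)
  2+r≤m : suc (suc r) ≤ m
  2+r≤m = ≤-trans (m≤m+n (suc (suc r)) k) (≤-reflexive (trans (cong suc (sym (+-suc r k))) 1+r+1+k≡m))
  1+r≤m : suc r ≤ m
  1+r≤m = ≤-trans (n≤1+n (suc r)) 2+r≤m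
  below : ∀ x → suc x + suc k ≡ m → rowInd m x * W x ≡ prefixes s (suc (suc k))
  below zero    1+1+k≡m rewrite rowInd-zero m =
    sym (prefixes-vanish s (suc (suc k)) (≤-trans (n≤1+n (suc s)) (≤-trans s<m (≤-reflexive (sym 1+1+k≡m)))))
  below (suc x) 2+x+1+k≡m =
    rowInd-edge m x _ _ (λ _ → IH x (suc (suc k)) (trans (+-suc (suc x) (suc k)) 2+x+1+k≡m))
      (λ m≤x → ⊥-elim (<⇒≱ (≤-trans (n≤1+n (suc x)) (≤-trans (m≤m+n (suc (suc x)) (suc k)) (≤-reflexive 2+x+1+k≡m)))
                            m≤x))
  lemma : ∀ a b c → a + b + c ≡ c + b + a
  lemma = solve-∀

D-bottom : ∀ m s → s < m → D m (suc s) 1 ≡ prefixTotal s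
D-bottom m s s<m = begin
  D m (suc s) 1                              ≡⟨ D-as-walks m s 1 ⟩
  ∑[ r < m ] walksBetween m s (suc r) 1      ≡⟨ ∑-cong m (walksBetween-to-bottom m s s<m) ⟩
  ∑< m (prefixes s)                          ≡⟨ ∑-prefixes s m s<m ⟩
  prefixTotal s                              ∎

walksFrom-bottom : ∀ m s → s < m → walksFrom m s 1 ≡ prefixTotal s
walksFrom-bottom m s s<m = begin
  walksFrom m s 1                            ≡⟨ walksFrom-as-∑ m s 1 row₁ ⟩
  ∑[ t < m ] walksBetween m s 1 (suc t)      ≡⟨ ∑-cong m (λ t t<m → walksBetween-sym m s 1 (suc t) row₁ (rowInd-in m t t<m)) ⟩
  ∑[ t < m ] walksBetween m s (suc t) 1      ≡⟨ ∑-cong m (walksBetween-to-bottom m s s<m) ⟩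
  ∑< m (prefixes s)                          ≡⟨ ∑-prefixes s m s<m ⟩
  prefixTotal s                              ∎
  where row₁ = rowInd-in m 0 (≤-trans z<s s<m)

walksFrom-top : ∀ m s → s < m → walksFrom m s m ≡ prefixTotal s
walksFrom-top (suc m) s s<m = begin
  walksFrom (suc m) s (suc m)
    ≡⟨ walksFrom-as-∑ (suc m) s (suc m) row-top ⟩
  ∑[ t < suc m ] walksBetween (suc m) s (suc m) (suc t)
    ≡⟨ ∑-cong (suc m) (λ t t<m → walksBetween-sym (suc m) s (suc m) (suc t) row-top (rowInd-in (suc m) t t<m)) ⟩
  ∑[ t < suc m ] walksBetween (suc m) s (suc t) (suc m)
    ≡⟨ ∑-cong (suc m) (λ t t<m → walksBetween-to-top (suc m) s s<m t (suc m ∸ suc t) (m+[n∸m]≡n t<m)) ⟩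
  ∑[ t < suc m ] prefixes s (suc m ∸ suc t)
    ≡⟨ ∑-reverse (suc m) (prefixes s) ⟩
  ∑< (suc m) (prefixes s)
    ≡⟨ ∑-prefixes s (suc m) s<m ⟩
  prefixTotal s ∎
  where row-top = rowInd-in (suc m) m ≤-refl

rowInd-in-* : ∀ m x a → suc x ≤ m → rowInd m (suc x) * a ≡ a
rowInd-in-* m x a x<m = trans (cong (_* a) (rowInd-in m x x<m)) (*-identityˡ a)

-- Each row lies next to itself and to its two neighbours, except that rows 1 and m miss a neighbour outside the table.
∑-neighbourSum : ∀ m v → 1 ≤ m → ∑[ i < m ] neighbourSum m v (suc i) + v 1 + v m ≡ 3 * ∑[ i < m ] v (suc i)
∑-neighbourSum (suc m) v _ = begin
  ∑[ i < suc m ] neighbourSum (suc m) v (suc i) + v 1 + v (suc m)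
    ≡⟨ cong (λ z → z + v 1 + v (suc m)) split ⟩
  A + B + C + v 1 + v (suc m)
    ≡⟨ lemma A B C (v 1) (v (suc m)) ⟩
  (A + v (suc m)) + B + (C + v 1)
    ≡⟨ cong₂ _+_ (cong₂ _+_ from-below itself) from-above ⟩
  Σv + Σv + Σv
    ≡⟨ triple Σv ⟩
  3 * Σv ∎
  where
  ι = rowInd (suc m)
  A = ∑[ i < suc m ] (ι i * v i)
  B = ∑[ i < suc m ] (ι (suc i) * v (suc i))
  C = ∑[ i < suc m ] (ι (suc (suc i)) * v (suc (suc i)))
  Σv = ∑[ i < suc m ] v (suc i)
  split : ∑[ i < suc m ] neighbourSum (suc m) v (suc i) ≡ A + B + C
  split = trans (∑-+ (suc m) (λ i → ι i * v i + ι (suc i) * v (suc i)) (λ i → ι (suc (suc i)) * v (suc (suc i))))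
                (cong (_+ C) (∑-+ (suc m) (λ i → ι i * v i) (λ i → ι (suc i) * v (suc i))))
  from-below : A + v (suc m) ≡ Σv
  from-below = trans (cong (_+ v (suc m)) (∑-cong m (λ i i<m → rowInd-in-* (suc m) i (v (suc i)) (m<n⇒m<1+n i<m))))
                     (sym (∑-snoc m (λ i → v (suc i))))
  itself : B ≡ Σv
  itself = ∑-cong (suc m) (λ i i<1+m → rowInd-in-* (suc m) i (v (suc i)) i<1+m)
  from-above : C + v 1 ≡ Σv
  from-above = begin
    C + v 1
      ≡⟨ cong (_+ v 1) (∑-snoc m (λ i → ι (suc (suc i)) * v (suc (suc i)))) ⟩
    ∑[ i < m ] (ι (suc (suc i)) * v (suc (suc i))) + ι (suc (suc m)) * v (suc (suc m)) + v 1
      ≡⟨ cong₂ (λ a b → a + b * v (suc (suc m)) + v 1)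
               (∑-cong m (λ i i<m → rowInd-in-* (suc m) (suc i) (v (suc (suc i))) (s≤s i<m))) (rowInd-out (suc m) (suc m) ≤-refl) ⟩
    ∑[ i < m ] v (suc (suc i)) + 0 + v 1
      ≡⟨ lemma (∑[ i < m ] v (suc (suc i))) (v 1) ⟩
    Σv ∎
    where lemma : ∀ a b → a + 0 + b ≡ b + a
          lemma = solve-∀
  lemma : ∀ a b c x y → a + b + c + x + y ≡ (a + y) + b + (c + x)
  lemma = solve-∀
  triple : ∀ a → a + a + a ≡ 3 * a
  triple = solve-∀

I-step : ∀ m s → s < m → I m (suc (suc s)) + 2 * prefixTotal s ≡ 3 * I m (suc s)
I-step m s s<m = begin
  I m (suc (suc s)) + 2 * prefixTotal s
    ≡⟨ cong₂ _+_ (I-as-walks m (suc s)) (double (prefixTotal s)) ⟩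
  ∑[ i < m ] walksFrom m (suc s) (suc i) + (prefixTotal s + prefixTotal s)
    ≡⟨ +-assoc (∑[ i < m ] walksFrom m (suc s) (suc i)) (prefixTotal s) (prefixTotal s) ⟨
  ∑[ i < m ] walksFrom m (suc s) (suc i) + prefixTotal s + prefixTotal s
    ≡⟨ cong₂ (λ a b → ∑[ i < m ] walksFrom m (suc s) (suc i) + a + b) (walksFrom-bottom m s s<m) (walksFrom-top m s s<m) ⟨
  ∑[ i < m ] neighbourSum m (walksFrom m s) (suc i) + walksFrom m s 1 + walksFrom m s m
    ≡⟨ ∑-neighbourSum m (walksFrom m s) (≤-trans z<s s<m) ⟩
  3 * ∑[ i < m ] walksFrom m s (suc i)
    ≡⟨ cong (3 *_) (I-as-walks m s) ⟨
  3 * I m (suc s) ∎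
  where double : ∀ a → 2 * a ≡ a + a
        double = solve-∀

pairSum : ∀ m k → k < m → ∑[ i < k ] (D m (suc i) 1 * D m (k ∸ i) 1) ≡ (shiftedMotzkin ⋆ (3 ^_)) k
pairSum m zero    _   = refl
pairSum m (suc j) j<m = begin
  ∑[ i < suc j ] (D m (suc i) 1 * D m (suc j ∸ i) 1)
    ≡⟨ ∑-cong (suc j) (λ i i≤j → cong₂ _*_ (D-bottom m i (<-≤-trans i≤j (<⇒≤ j<m)))
         (trans (cong (λ z → D m z 1) (+-∸-assoc 1 (≤-pred i≤j)))
                (D-bottom m (j ∸ i) (≤-<-trans (m∸n≤m j i) (<⇒≤ j<m))))) ⟩
  ∑[ i < suc j ] (prefixTotal i * prefixTotal (j ∸ i))
    ≡⟨ ⋆-as-∑ prefixTotal prefixTotal j ⟨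
  (prefixTotal ⋆ prefixTotal) j
    ≡⟨ prefixTotal⋆prefixTotal j ⟩
  (shiftedMotzkin ⋆ (3 ^_)) (suc j) ∎

[2+j]∸i∸2≡j∸i : ∀ j i → suc (suc j) ∸ i ∸ 2 ≡ j ∸ i
[2+j]∸i∸2≡j∸i j i = trans (∸-+-assoc (suc (suc j)) i 2) (trans (cong (suc (suc j) ∸_) (+-comm i 2)) ([m+n]∸[m+o]≡n∸o 2 j i))

shiftedMotzkin⋆pow3-as-Σ : ∀ k → (shiftedMotzkin ⋆ (3 ^_)) k ≡ Σ[ 0 , k ⟩ (λ i → 3 ^ (suc k ∸ i ∸ 2) * Motzkin i)
shiftedMotzkin⋆pow3-as-Σ k = trans (as-∑ k) (sym (Σ[⟩-as-∑ 0 k _))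
  where
  as-∑ : ∀ k → (shiftedMotzkin ⋆ (3 ^_)) k ≡ ∑[ i < k ] (3 ^ (suc k ∸ i ∸ 2) * Motzkin i)
  as-∑ zero    = refl
  as-∑ (suc j) = trans (⋆-as-∑ motzkin (3 ^_) j) (∑-cong (suc j) (λ i _ →
    trans (*-comm (motzkin i) (3 ^ (j ∸ i))) (cong₂ _*_ (cong (3 ^_) (sym ([2+j]∸i∸2≡j∸i j i))) (sym (Motzkin≡motzkin i)))))

shiftedMotzkin⋆weighted-as-Σ : ∀ k → (shiftedMotzkin ⋆ (λ b → b * 3 ^ b)) k
                                     ≡ Σ[ 0 , suc k ∸ 2 ⟩ (λ q → (suc k ∸ q ∸ 2) * 3 ^ (suc k ∸ q ∸ 2) * Motzkin q)
shiftedMotzkin⋆weighted-as-Σ k = trans (as-∑ k) (sym (Σ[⟩-as-∑ 0 (suc k ∸ 2) _))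
  where
  as-∑ : ∀ k → (shiftedMotzkin ⋆ (λ b → b * 3 ^ b)) k
               ≡ ∑[ q < suc k ∸ 2 ] ((suc k ∸ q ∸ 2) * 3 ^ (suc k ∸ q ∸ 2) * Motzkin q)
  as-∑ zero    = refl
  as-∑ (suc j) = begin
    (motzkin ⋆ w) j
      ≡⟨ ⋆-as-∑ motzkin w j ⟩
    ∑[ q < suc j ] (motzkin q * w (j ∸ q))
      ≡⟨ ∑-snoc j (λ q → motzkin q * w (j ∸ q)) ⟩
    ∑[ q < j ] (motzkin q * w (j ∸ q)) + motzkin j * w (j ∸ j)
      ≡⟨ cong (λ z → ∑[ q < j ] (motzkin q * w (j ∸ q)) + motzkin j * w z) (n∸n≡0 j) ⟩
    ∑[ q < j ] (motzkin q * w (j ∸ q)) + motzkin j * 0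
      ≡⟨ +-*-zeroʳ (∑[ q < j ] (motzkin q * w (j ∸ q))) (motzkin j) ⟩
    ∑[ q < j ] (motzkin q * w (j ∸ q))
      ≡⟨ ∑-cong j (λ q _ → trans (*-comm (motzkin q) (w (j ∸ q)))
                                 (cong₂ _*_ (cong w (sym ([2+j]∸i∸2≡j∸i j q))) (sym (Motzkin≡motzkin q)))) ⟩
    ∑[ q < j ] ((suc (suc j) ∸ q ∸ 2) * 3 ^ (suc (suc j) ∸ q ∸ 2) * Motzkin q) ∎
    where w = λ b → b * 3 ^ b

shiftedMotzkin⋆weighted-suc : ∀ s → (shiftedMotzkin ⋆ (λ b → b * 3 ^ b)) (suc s)
                                    ≡ 3 * (shiftedMotzkin ⋆ (λ b → b * 3 ^ b)) s + 3 * (shiftedMotzkin ⋆ (3 ^_)) s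
shiftedMotzkin⋆weighted-suc s = begin
  (shiftedMotzkin ⋆ (λ b → b * 3 ^ b)) (suc s)
    ≡⟨ ⋆-snoc shiftedMotzkin (λ b → b * 3 ^ b) s ⟩
  (shiftedMotzkin ⋆ (λ b → suc b * 3 ^ suc b)) s + shiftedMotzkin (suc s) * 0
    ≡⟨ +-*-zeroʳ ((shiftedMotzkin ⋆ (λ b → suc b * 3 ^ suc b)) s) (shiftedMotzkin (suc s)) ⟩
  (shiftedMotzkin ⋆ (λ b → suc b * 3 ^ suc b)) s
    ≡⟨ ⋆-congʳ shiftedMotzkin s (λ b _ → lemma b (3 ^ b)) ⟩
  (shiftedMotzkin ⋆ (λ b → 3 * (b * 3 ^ b) + 3 * 3 ^ b)) s
    ≡⟨ ⋆-distribˡ-+ shiftedMotzkin (λ b → 3 * (b * 3 ^ b)) (λ b → 3 * 3 ^ b) s ⟩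
  (shiftedMotzkin ⋆ (λ b → 3 * (b * 3 ^ b))) s + (shiftedMotzkin ⋆ (λ b → 3 * 3 ^ b)) s
    ≡⟨ cong₂ _+_ (⋆-scaleʳ 3 shiftedMotzkin (λ b → b * 3 ^ b) s) (⋆-scaleʳ 3 shiftedMotzkin (3 ^_) s) ⟩
  3 * (shiftedMotzkin ⋆ (λ b → b * 3 ^ b)) s + 3 * (shiftedMotzkin ⋆ (3 ^_)) s ∎
  where lemma : ∀ b p → suc b * (3 * p) ≡ 3 * (b * p) + 3 * p
        lemma = solve-∀

-- Stated with both sides moved so that no subtraction occurs; the step cancels 6 · prefixTotal s.
I-closed-form : ∀ m s → s < m →
                3 * I m (suc s) + 2 * (s * 3 ^ s) ≡ 3 * (m * 3 ^ s) + 2 * (shiftedMotzkin ⋆ (λ b → b * 3 ^ b)) s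
I-closed-form m zero    _   = begin
  3 * I m 1 + 0       ≡⟨ +-identityʳ _ ⟩
  3 * I m 1           ≡⟨ cong (3 *_) (trans (I-as-walks m 0) (∑-one m)) ⟩
  3 * m               ≡⟨ cong (3 *_) (*-identityʳ m) ⟨
  3 * (m * 1)         ≡⟨ +-identityʳ _ ⟨
  3 * (m * 1) + 0     ∎
I-closed-form m (suc s) s<m = +-cancelʳ-≡ (6 * t) _ _ (begin
  3 * I m (suc (suc s)) + 2 * (suc s * (3 * p)) + 6 * t
    ≡⟨ lemma₁ (I m (suc (suc s))) t s p ⟩
  3 * (I m (suc (suc s)) + 2 * t) + 6 * (s * p) + 6 * p
    ≡⟨ cong (λ z → 3 * z + 6 * (s * p) + 6 * p) (I-step m s s<m′) ⟩
  3 * (3 * I m (suc s)) + 6 * (s * p) + 6 * p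
    ≡⟨ lemma₂ (I m (suc s)) s p ⟩
  3 * (3 * I m (suc s) + 2 * (s * p)) + 6 * p
    ≡⟨ cong₂ (λ a b → 3 * a + 6 * b) (I-closed-form m s s<m′) (pow3-split s) ⟩
  3 * (3 * (m * p) + 2 * W s) + 6 * (t + C s)
    ≡⟨ lemma₃ m p (W s) t (C s) ⟩
  3 * (m * (3 * p)) + 2 * (3 * W s + 3 * C s) + 6 * t
    ≡⟨ cong (λ z → 3 * (m * (3 * p)) + 2 * z + 6 * t) (shiftedMotzkin⋆weighted-suc s) ⟨
  3 * (m * (3 * p)) + 2 * W (suc s) + 6 * t ∎)
  where
  s<m′ = <⇒≤ s<m
  t = prefixTotal s
  p = 3 ^ s
  C = shiftedMotzkin ⋆ (3 ^_)
  W = shiftedMotzkin ⋆ (λ b → b * 3 ^ b)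
  lemma₁ : ∀ g t s p → 3 * g + 2 * (suc s * (3 * p)) + 6 * t ≡ 3 * (g + 2 * t) + 6 * (s * p) + 6 * p
  lemma₁ = solve-∀
  lemma₂ : ∀ g s p → 3 * (3 * g) + 6 * (s * p) + 6 * p ≡ 3 * (3 * g + 2 * (s * p)) + 6 * p
  lemma₂ = solve-∀
  lemma₃ : ∀ m p w t c → 3 * (3 * (m * p) + 2 * w) + 6 * (t + c) ≡ 3 * (m * (3 * p)) + 2 * (3 * w + 3 * c) + 6 * t
  lemma₃ = solve-∀

I-formula : ∀ m k → k < m →
            3 * I m (suc k) ≡ (3 * m + 2 ∸ 2 * suc k) * 3 ^ k + 2 * (shiftedMotzkin ⋆ (λ b → b * 3 ^ b)) k
I-formula m k k<m = begin
  3 * I m (suc k)                       ≡⟨ +-cancelʳ-≡ (2 * (k * p)) _ _ cancelled ⟩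
  (3 * m ∸ 2 * k) * p + 2 * W           ≡⟨ cong (λ x → x * p + 2 * W) 3m+2∸2n≡3m∸2k ⟨
  (3 * m + 2 ∸ 2 * suc k) * p + 2 * W   ∎
  where
  p = 3 ^ k
  W = (shiftedMotzkin ⋆ (λ b → b * 3 ^ b)) k
  3m+2∸2n≡3m∸2k : 3 * m + 2 ∸ 2 * suc k ≡ 3 * m ∸ 2 * k
  3m+2∸2n≡3m∸2k = trans (cong₂ _∸_ (+-comm (3 * m) 2) (*-suc 2 k)) ([m+n]∸[m+o]≡n∸o 2 (3 * m) (2 * k))
  2k≤3m : 2 * k ≤ 3 * m
  2k≤3m = *-mono-≤ {2} {3} (s≤s (s≤s z≤n)) (<⇒≤ k<m)
  lemma : ∀ x k p w → (x + 2 * k) * p + 2 * w ≡ x * p + 2 * w + 2 * (k * p)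
  lemma = solve-∀
  cancelled : 3 * I m (suc k) + 2 * (k * p) ≡ (3 * m ∸ 2 * k) * p + 2 * W + 2 * (k * p)
  cancelled = begin
    3 * I m (suc k) + 2 * (k * p)             ≡⟨ I-closed-form m k k<m ⟩
    3 * (m * p) + 2 * W                       ≡⟨ cong (_+ 2 * W) (*-assoc 3 m p) ⟨
    3 * m * p + 2 * W                         ≡⟨ cong (λ z → z * p + 2 * W) (m∸n+n≡m 2k≤3m) ⟨
    (3 * m ∸ 2 * k + 2 * k) * p + 2 * W       ≡⟨ lemma (3 * m ∸ 2 * k) k p W ⟩
    (3 * m ∸ 2 * k) * p + 2 * W + 2 * (k * p) ∎

2n∸2≤m⇒n≤m : ∀ n m → 1 ≤ n → 1 ≤ m → 2 * n ∸ 2 ≤ m → n ≤ m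
2n∸2≤m⇒n≤m (suc zero)    m _ 1≤m _ = 1≤m
2n∸2≤m⇒n≤m (suc (suc k)) m _ _   h = ≤-trans (≤-trans (m≤n+m (suc (suc k)) k)
                                                       (≤-reflexive (cong (λ z → k + suc (suc z)) (sym (+-identityʳ k))))) h

theorem2p11 : (n m : ℕ) → 1 ≤ n → 1 ≤ m → 2 * n ∸ 2 ≤ m →
    (Σ[ 0 , n ⟩ (λ i → D m i 1 * D m (n ∸ i) 1) ≡ 3 ^ (n ∸ 1))
    × (Σ[ 1 , n ⟩ (λ i → D m i 1 * D m (n ∸ i) 1)
        ≡ Σ[ 0 , n ∸ 1 ⟩ (λ i → 3 ^ (n ∸ i ∸ 2) * Motzkin i))
    × (3 * I m n
        ≡ (3 * m + 2 ∸ 2 * n) * 3 ^ (n ∸ 1)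
          + 2 * Σ[ 0 , n ∸ 2 ⟩ (λ k → (n ∸ k ∸ 2) * 3 ^ (n ∸ k ∸ 2) * Motzkin k))
theorem2p11 (suc k) m 1≤n 1≤m 2n∸2≤m = part-i , part-ii , part-iii
  where
  k<m = 2n∸2≤m⇒n≤m (suc k) m 1≤n 1≤m 2n∸2≤m
  part-i = begin
    Σ[ 0 , suc k ⟩ (λ i → D m i 1 * D m (suc k ∸ i) 1)
      ≡⟨ Σ[⟩-as-∑ 0 (suc k) (λ i → D m i 1 * D m (suc k ∸ i) 1) ⟩
    1 * D m (suc k) 1 + ∑[ i < k ] (D m (suc i) 1 * D m (k ∸ i) 1)
      ≡⟨ cong₂ _+_ (trans (*-identityˡ _) (D-bottom m k k<m)) (pairSum m k k<m) ⟩
    prefixTotal k + (shiftedMotzkin ⋆ (3 ^_)) k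
      ≡⟨ pow3-split k ⟨
    3 ^ k ∎
  part-ii = trans (Σ[⟩-as-∑ 1 (suc k) (λ i → D m i 1 * D m (suc k ∸ i) 1))
                  (trans (pairSum m k k<m) (shiftedMotzkin⋆pow3-as-Σ k))
  part-iii = trans (I-formula m k k<m)
                   (cong (λ w → (3 * m + 2 ∸ 2 * suc k) * 3 ^ k + 2 * w) (shiftedMotzkin⋆weighted-as-Σ k))
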